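{- Let $\mathcal{U}$ be a Ramsey for $\mathcal{R}_1$ ultrafilter on $[T_1]$ generated by $\mathcal{C}\subseteq\mathcal{R}_1$, and let $p:[T_1]\to\omega$ be a map such that the cut associated to $p$ and $\mathcal{U}$ is proper. Then the cut associated to $p$ and $\mathcal{U}$ is the standard cut in $\omega^{\omega}/p(\mathcal{U})$.
   Context: For $f:X\to Y$ and an ultrafilter $\mathcal{U}$ on $X$, $f(\mathcal{U})$ is the ultrafilter generated by $\{f''Z:Z\in\mathcal{U}\}$. The ultrapower $\omega^{\omega}/\mathcal{V}$ is linearly ordered by $[f]\le[g]$ iff $\{n:f(n)\le g(n)\}\in\mathcal{V}$. A Dedekind cut $(S,L)$ partitions it with no element of $L$ below an element of $S$; it is proper if $L\ne\emptyset$ and $S$ contains all classes of constant maps; the standard cut has $S$ equal to the set of classes of constant maps. Cut associated to $p$ and $\mathcal{U}$: with $C_A(n)=|A\cap p^{ -1}\{n\}|$, $L$ is the set of classes of $C_A$ for $A\in\mathcal{U}$ with $C_A$ finite-valued, together with all larger elements of $\omega^{\omega}/p(\mathcal{U})$; $S$ is the complement. The space $\mathcal{R}_1$: $T_1(i)=\{\langle\rangle,\langle i\rangle\}\cup\{\langle i,j\rangle: i(i+1)\le 2j<(i+1)(i+2)\}$, $T_1=\bigcup_iT_1(i)$; $\mathcal{R}_1$ is the set of subtrees $S\subseteq T_1$ with strictly increasing $(k_i)$ such that $S\cap T_1(k_i)$ is isomorphic to $T_1(i)$ (contains $\langle\rangle,\langle k_i\rangle$ and exactly $i+1$ length-two nodes)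 and $S\cap T_1(k)\ne\{\langle\rangle\}$ only if $k=k_i$ for some $i$. $S(i)=S\cap T_1(k_i)$, $r_i(S)=\bigcup_{j<i}S(j)$, $\mathcal{AR}_i=\{r_i(S):S\in\mathcal{R}_1\}$, $\mathcal{AR}_i|S=\{s\in\mathcal{AR}_i:s\subseteq S\}$; $[S]$, $[T_1]$ are the sets of length-two nodes. $\mathcal{U}$ on $[T_1]$ is generated by $\mathcal{C}$ if $\{[S]:S\in\mathcal{C}\}$ is cofinal in $(\mathcal{U},\supseteq)$; it is Ramsey for $\mathcal{R}_1$ if for every $i$ and every 2-partition of $\mathcal{AR}_i$ there is $S\in\mathcal{C}$ with $\mathcal{AR}_i|S$ in one part. -}

module Defs where

open import Level using (0ℓ)
open import Data.Nat using (ℕ; suc; _≤_; _<_)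
open import Data.Fin using (Fin; toℕ)
open import Data.Fin.Subset using (Subset; ∣_∣) renaming (_∈_ to _∈ₛ_)
open import Data.Vec using (Vec; tabulate)
open import Data.Bool using (Bool)
open import Data.List using (List; length)
open import Data.List.Membership.Propositional using () renaming (_∈_ to _∈ₗ_)
open import Data.List.Relation.Unary.Unique.Propositional using (Unique)
open import Data.Product using (Σ; _×_; _,_; proj₁; proj₂)
open import Data.Sum using (_⊎_)
open import Data.Unit using (⊤)
open import Data.Empty using (⊥)
open import Relation.Unary using (Pred; ∁; _∩_; _⊆_)
open import Relation.Nullary using (¬_)
open import Relation.Binary.PropositionalEquality using (_≡_; subst)

record IsUltrafilter {X : Set} (U : Pred X 0ℓ → Set) : Set₁ where
  field
    whole  : U (λ _ → ⊤)
    nonempty : ¬ U (λ _ → ⊥)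
    upward : ∀ {A B : Pred X 0ℓ} → A ⊆ B → U A → U B
    meet   : ∀ {A B : Pred X 0ℓ} → U A → U B → U (A ∩ B)
    ultra  : ∀ (A : Pred X 0ℓ) → U A ⊎ U (∁ A)

-- f(U): the ultrafilter generated by {f''Z : Z ∈ U}
imageUF : {X Y : Set} → (X → Y) → (Pred X 0ℓ → Set) → (Pred Y 0ℓ → Set₁)
imageUF {X} f U B = Σ (Pred X 0ℓ) λ Z → U Z × (∀ x → Z x → B (f x))

-- The ultrapower ω^ω / V, elements represented by functions ℕ → ℕ

_≤[_]_ : (ℕ → ℕ) → (Pred ℕ 0ℓ → Set₁) → (ℕ → ℕ) → Set₁
f ≤[ V ] g = V (λ n → f n ≤ g n)

_≈[_]_ : (ℕ → ℕ) → (Pred ℕ 0ℓ → Set₁) → (ℕ → ℕ) → Set₁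
f ≈[ V ] g = V (λ n → f n ≡ g n)

const : ℕ → ℕ → ℕ
const m _ = m

-- Length-two nodes of T_1.  A node (i , t) with t : Fin (suc i) stands for
-- ⟨i, i(i+1)/2 + t⟩; these are exactly the ⟨i,j⟩ with
-- i(i+1) ≤ 2j < (i+1)(i+2).  So Node = [T_1].

Node : Set
Node = Σ ℕ (λ i → Fin (suc i))

-- A "level": a number m together with a set of length-two nodes of T_1(m)
Level : Set
Level = Σ ℕ (λ m → Subset (suc m))

_∈Level_ : Node → Level → Set
(m′ , t) ∈Level (m , s) = Σ (m′ ≡ m) (λ eq → subst (λ j → Fin (suc j)) eq t ∈ₛ s)

-- S is determined by the strictly increasing sequence (k_i)
-- (the length-one nodes ⟨k_i⟩) and, for each i, the set of length-two nodes
-- of S(i) = S ∩ T_1(k_i), which has exactly i+1 elements.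
record R1 : Set where
  field
    k           : ℕ → ℕ
    k-incr      : ∀ i → k i < k (suc i)
    chosen      : (i : ℕ) → Subset (suc (k i))
    chosen-size : ∀ i → ∣ chosen i ∣ ≡ suc i

levelOf : R1 → ℕ → Level
levelOf S i = R1.k S i , R1.chosen S i

⟦_⟧ : R1 → Pred Node 0ℓ
⟦ S ⟧ x = Σ ℕ λ i → x ∈Level levelOf S i

-- r_i(S) = ⋃_{j<i} S(j), encoded by its levels S(0),…,S(i-1)
r : (i : ℕ) → R1 → Vec Level i
r i S = tabulate (λ j → levelOf S (toℕ j))

-- r_i(S′) ⊆ S as trees (length-one nodes and length-two nodes)
_⊆AR[_]_ : R1 → ℕ → R1 → Set
S′ ⊆AR[ i ] S = ∀ j → j < i →
  (Σ ℕ λ m → R1.k S′ j ≡ R1.k S m) × (∀ x → x ∈Level levelOf S′ j → ⟦ S ⟧ x)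

GeneratedBy : (Pred Node 0ℓ → Set) → (R1 → Set) → Set₁
GeneratedBy U C =
  (∀ S → C S → U ⟦ S ⟧) × (∀ (A : Pred Node 0ℓ) → U A → Σ R1 λ S → C S × ⟦ S ⟧ ⊆ A)

RamseyR1 : (R1 → Set) → Set
RamseyR1 C = ∀ (i : ℕ) (c : Vec Level i → Bool) →
  Σ R1 λ S → C S × Σ Bool λ b → ∀ (S′ : R1) → S′ ⊆AR[ i ] S → c (r i S′) ≡ b

HasSize : Pred Node 0ℓ → ℕ → Set
HasSize P m = Σ (List Node) λ xs →
  Unique xs × length xs ≡ m × (∀ x → (P x → x ∈ₗ xs) × (x ∈ₗ xs → P x))

module Cut (U : Pred Node 0ℓ → Set) (p : Node → ℕ) where

  pU : Pred ℕ 0ℓ → Set₁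
  pU = imageUF p U

  CountIs : Pred Node 0ℓ → (ℕ → ℕ) → Set
  CountIs A g = ∀ n → HasSize (λ x → A x × p x ≡ n) (g n)

  InL : (ℕ → ℕ) → Set₁
  InL f = Σ (Pred Node 0ℓ) λ A → U A × Σ (ℕ → ℕ) λ g → CountIs A g × g ≤[ pU ] f

  InS : (ℕ → ℕ) → Set₁
  InS f = ¬ InL f

  IsConstantClass : (ℕ → ℕ) → Set₁
  IsConstantClass f = Σ ℕ λ m → f ≈[ pU ] const m

  Proper : Set₁
  Proper = (Σ (ℕ → ℕ) InL) × (∀ m → InS (const m))

  Standard : Set₁
  Standard = ∀ f → (InS f → IsConstantClass f) × (IsConstantClass f → InS f)

-- Colour a pair of levels L₀, L₁ of elements of R₁ by whether p(L₀) and p(L₁) are disjoint and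
-- f ∘ p exceeds height(L₀) + 2 on L₁, and take S ∈ C homogeneous for this colouring of AR₂.
-- If the colour is "yes", distinct levels of S have disjoint p-images, so off its bottom level S
-- has at most |S(i+1)| = i + 2 ≤ k_i + 2 nodes over p(y) for y ∈ S(i+1), fewer than f(p(y));
-- intersecting with any A ∈ U with finite counts witnesses [f] ∈ L. If it is "no", f ∘ p is
-- bounded on a set in U: otherwise a generator inside the region where f ∘ p is large yields,
-- with the bottom node of S, a pair coloured "yes". A bounded class of ω^ω/p(U) is constant.
-- Conversely constant classes lie in S by properness, as L is an upper set.
module Submission where

open import Defs
open import Level using (0ℓ)
open import Data.Nat using (ℕ; zero; suc; _+_; _≤_; _<_; z≤n; s≤s)
open import Data.Nat.Properties
  using (≤-refl; ≤-trans; ≤-<-trans; <-trans; ≤-reflexive; <⇒≤; <⇒≱; ≰⇒>; ≤-pred; ≤∧≢⇒<;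
         n≤0⇒n≡0; n<1+n; m≤m+n; m≤n+m; <⇒≢; <-cmp; m≤n⇒m<n∨m≡n; m<1+n⇒m<n∨m≡n;
         module ≤-Reasoning)
open import Data.Fin using (Fin; _≟_)
open import Data.Fin.Properties using (any?)
open import Data.Fin.Subset
  using (Subset; ∣_∣; ⁅_⁆; _∪_; _-_; Nonempty; inside)
  renaming (_∈_ to _∈ₛ_; _⊆_ to _⊆ₛ_; ⊥ to ∅)
open import Data.Fin.Subset.Properties
  using (_∈?_; nonempty?; Empty-unique; ∣⊥∣≡0; ∣⁅x⁆∣≡1; x∈⁅x⁆; x∈⁅y⁆⇒x≡y; x∈p∪q⁺; x∈p∪q⁻;
         ∪-identityˡ; ∪-identityʳ; x∈p∧x≢y⇒x∈p-y; x∈p⇒∣p-x∣<∣p∣; p⊆q⇒∣p∣≤∣q∣)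
open import Data.Vec using (Vec; []; _∷_; replicate; _++_)
open import Data.Bool using (Bool; true; false; if_then_else_)
open import Data.List using (List; _∷_; length; filter)
open import Data.List.Relation.Unary.All using (All; []; _∷_; zipWith; tabulate)
open import Data.List.Relation.Unary.AllPairs using ([]; _∷_)
open import Data.List.Relation.Unary.Unique.Propositional using (Unique)
open import Data.List.Relation.Unary.Unique.Propositional.Properties using (filter⁺)
open import Data.List.Membership.Propositional.Properties using (∈-filter⁺; ∈-filter⁻)
open import Data.Product using (Σ; ∃; _×_; _,_; proj₁; proj₂; map₂)
open import Data.Sum using (inj₁; inj₂)
open import Data.Empty using (⊥; ⊥-elim)
open import Function using (id; _∘_)
open import Relation.Unary using (Pred; Decidable; _∩_; _⊆_)
open import Relation.Nullary using (¬_; Dec; yes; no; does; proof; ¬?; _×-dec_; contradiction)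
open import Relation.Nullary.Reflects using (Reflects; invert)
open import Relation.Binary.Definitions using (tri<; tri≈; tri>)
open import Relation.Binary.PropositionalEquality using (_≡_; _≢_; refl; sym; trans; cong; subst)

open R1 using (k; k-incr; chosen; chosen-size)

∣p∣≡suc⇒nonempty : ∀ {n m} (s : Subset n) → ∣ s ∣ ≡ suc m → Nonempty s
∣p∣≡suc⇒nonempty {n} s ∣s∣≡1+m with nonempty? s
... | yes s≠∅ = s≠∅
... | no s=∅ = contradiction (trans (sym ∣s∣≡1+m) (trans (cong ∣_∣ (Empty-unique s=∅)) (∣⊥∣≡0 n))) λ ()

x∈p⇒⁅x⁆⊆p : ∀ {n} {x : Fin n} {s : Subset n} → x ∈ₛ s → ⁅ x ⁆ ⊆ₛ s
x∈p⇒⁅x⁆⊆p {x = x} x∈s y∈⁅x⁆ = subst (_∈ₛ _) (sym (x∈⁅y⁆⇒x≡y x y∈⁅x⁆)) x∈s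

∣⁅x⁆∪⁅y⁆∣≡2 : ∀ {n} (x y : Fin n) → x ≢ y → ∣ ⁅ x ⁆ ∪ ⁅ y ⁆ ∣ ≡ 2
∣⁅x⁆∪⁅y⁆∣≡2 Fin.zero Fin.zero x≢y = contradiction refl x≢y
∣⁅x⁆∪⁅y⁆∣≡2 Fin.zero (Fin.suc y) _ = cong suc (trans (cong ∣_∣ (∪-identityˡ ⁅ y ⁆)) (∣⁅x⁆∣≡1 y))
∣⁅x⁆∪⁅y⁆∣≡2 (Fin.suc x) Fin.zero _ = cong suc (trans (cong ∣_∣ (∪-identityʳ ⁅ x ⁆)) (∣⁅x⁆∣≡1 x))
∣⁅x⁆∪⁅y⁆∣≡2 (Fin.suc x) (Fin.suc y) x≢y = ∣⁅x⁆∪⁅y⁆∣≡2 x y (x≢y ∘ cong Fin.suc)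

∃-other : ∀ {n} {s : Subset n} (y : Fin n) → 2 ≤ ∣ s ∣ → ∃ λ z → z ∈ₛ s × z ≢ y
∃-other {s = s} y 2≤∣s∣ with any? (λ z → z ∈? s ×-dec ¬? (z ≟ y))
... | yes other = other
... | no no-other = contradiction (subst (∣ s ∣ ≤_) (∣⁅x⁆∣≡1 y) (p⊆q⇒∣p∣≤∣q∣ s⊆⁅y⁆)) (<⇒≱ 2≤∣s∣)
  where
  s⊆⁅y⁆ : s ⊆ₛ ⁅ y ⁆
  s⊆⁅y⁆ {z} z∈s with z ≟ y
  ... | yes refl = x∈⁅x⁆ y
  ... | no z≢y = contradiction (z , z∈s , z≢y) no-other

pair-containing : ∀ {n} {s : Subset n} {y : Fin n} → y ∈ₛ s → 2 ≤ ∣ s ∣ →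
                  Σ (Subset n) λ t → ∣ t ∣ ≡ 2 × y ∈ₛ t × t ⊆ₛ s
pair-containing {s = s} {y} y∈s 2≤∣s∣ with ∃-other y 2≤∣s∣
... | z , z∈s , z≢y =
  ⁅ y ⁆ ∪ ⁅ z ⁆ , ∣⁅x⁆∪⁅y⁆∣≡2 y z (z≢y ∘ sym) , x∈p∪q⁺ (inj₁ (x∈⁅x⁆ y)) , pair⊆s
  where
  pair⊆s : ⁅ y ⁆ ∪ ⁅ z ⁆ ⊆ₛ s
  pair⊆s x∈ with x∈p∪q⁻ ⁅ y ⁆ ⁅ z ⁆ x∈
  ... | inj₁ x∈⁅y⁆ = x∈p⇒⁅x⁆⊆p y∈s x∈⁅y⁆
  ... | inj₂ x∈⁅z⁆ = x∈p⇒⁅x⁆⊆p z∈s x∈⁅z⁆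

∈Level-remove : ∀ {m} {s : Subset (suc m)} {t} {x : Node} →
                x ∈Level (m , s) → (m , t) ≢ x → x ∈Level (m , s - t)
∈Level-remove {m} (refl , u∈s) t≢u = refl , x∈p∧x≢y⇒x∈p-y u∈s (t≢u ∘ cong (m ,_) ∘ sym)

unique-level-length≤ : ∀ {m} {s : Subset (suc m)} {xs : List Node} →
                       Unique xs → All (_∈Level (m , s)) xs → length xs ≤ ∣ s ∣
unique-level-length≤ [] [] = z≤n
unique-level-length≤ {m} {s} {(_ , t) ∷ ys} (x∉ys ∷ ys-unique) ((refl , t∈s) ∷ ys∈) =
  ≤-trans (s≤s (unique-level-length≤ ys-unique ys∈s-t)) (x∈p⇒∣p-x∣<∣p∣ t∈s)
  where
  ys∈s-t : All (_∈Level (m , s - t)) ys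
  ys∈s-t = zipWith (λ (y∈ , x≢y) → ∈Level-remove y∈ x≢y) (ys∈ , x∉ys)

HasSize-resp : ∀ {P Q : Pred Node 0ℓ} {m} → (∀ x → P x → Q x) → (∀ x → Q x → P x) →
               HasSize P m → HasSize Q m
HasSize-resp P⇒Q Q⇒P (xs , xs-unique , ∣xs∣≡m , xs≗P) =
  xs , xs-unique , ∣xs∣≡m , λ x → (proj₁ (xs≗P x) ∘ Q⇒P x) , (P⇒Q x ∘ proj₂ (xs≗P x))

HasSize-∩ : ∀ {P Q : Pred Node 0ℓ} {m} → Decidable Q → HasSize P m → ∃ (HasSize (P ∩ Q))
HasSize-∩ Q? (xs , xs-unique , _ , xs≗P) =
  length (filter Q? xs) , filter Q? xs , filter⁺ Q? xs-unique , refl ,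
  λ x → (λ (Px , Qx) → ∈-filter⁺ Q? (proj₁ (xs≗P x) Px) Qx) ,
        (λ x∈ → let x∈xs , Qx = ∈-filter⁻ Q? x∈ in proj₂ (xs≗P x) x∈xs , Qx)

HasSize-level≤ : ∀ {P : Pred Node 0ℓ} {n m} {s : Subset (suc m)} →
                 HasSize P n → (∀ x → P x → x ∈Level (m , s)) → n ≤ ∣ s ∣
HasSize-level≤ (xs , xs-unique , refl , xs≗P) P⊆level =
  unique-level-length≤ xs-unique (tabulate λ {x} x∈xs → P⊆level x (proj₂ (xs≗P x) x∈xs))

module _ (S : R1) where

  k-strictMono : ∀ {i j} → i < j → k S i < k S j
  k-strictMono {i} {suc j} i<1+j with m<1+n⇒m<n∨m≡n i<1+j
  ... | inj₁ i<j = <-trans (k-strictMono i<j) (k-incr S j)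
  ... | inj₂ refl = k-incr S j

  k-mono : ∀ {i j} → i ≤ j → k S i ≤ k S j
  k-mono i≤j with m≤n⇒m<n∨m≡n i≤j
  ... | inj₁ i<j = <⇒≤ (k-strictMono i<j)
  ... | inj₂ refl = ≤-refl

  i≤k : ∀ i → i ≤ k S i
  i≤k zero = z≤n
  i≤k (suc i) = ≤-trans (s≤s (i≤k i)) (k-incr S i)

  pick : ∀ i → Fin (suc (k S i))
  pick i = proj₁ (∣p∣≡suc⇒nonempty (chosen S i) (chosen-size S i))

  pick∈ : ∀ i → pick i ∈ₛ chosen S i
  pick∈ i = proj₂ (∣p∣≡suc⇒nonempty (chosen S i) (chosen-size S i))

  node : ℕ → Node
  node i = k S i , pick i

  node∈level : ∀ i → node i ∈Level levelOf S i
  node∈level i = refl , pick∈ i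

  node∈⟦⟧ : ∀ i → ⟦ S ⟧ (node i)
  node∈⟦⟧ i = i , node∈level i

  height-in : ∀ {x} → ⟦ S ⟧ x → Σ ℕ λ j → proj₁ x ≡ k S j
  height-in (j , height≡ , _) = j , height≡

_⊑_ : Level → R1 → Set
(a , s) ⊑ S = (Σ ℕ λ j → a ≡ k S j) × (∀ x → x ∈Level (a , s) → ⟦ S ⟧ x)

sublevel⊑ : ∀ (S : R1) i {s} → s ⊆ₛ chosen S i → (k S i , s) ⊑ S
sublevel⊑ S i s⊆ = (i , refl) , λ { (_ , t) (refl , t∈s) → i , refl , s⊆ t∈s }

level⊑ : ∀ {S T : R1} → ⟦ T ⟧ ⊆ ⟦ S ⟧ → ∀ i → levelOf T i ⊑ S
level⊑ {S} {T} T⊆S i = height-in S (T⊆S (node∈⟦⟧ T i)) , λ x x∈ → T⊆S (i , x∈)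

filled : (n b : ℕ) → Subset (n + b)
filled n b = replicate n inside ++ ∅

∣filled∣ : ∀ n b → ∣ filled n b ∣ ≡ n
∣filled∣ zero b = ∣⊥∣≡0 b
∣filled∣ (suc n) b = cong suc (∣filled∣ n b)

-- Only the first two levels matter (through r₂); the later ones are arbitrary.
twoLevels : ∀ {a b} (s₀ : Subset (suc a)) (s₁ : Subset (suc b)) →
            ∣ s₀ ∣ ≡ 1 → ∣ s₁ ∣ ≡ 2 → a < b → R1
twoLevels {a} {b} s₀ s₁ ∣s₀∣≡1 ∣s₁∣≡2 a<b =
  record { k = K ; k-incr = K-incr ; chosen = ch ; chosen-size = ch-size }
  where
  K : ℕ → ℕ
  K 0 = a
  K 1 = b
  K (suc (suc i)) = suc (suc i) + b
  K-incr : ∀ i → K i < K (suc i)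
  K-incr 0 = a<b
  K-incr 1 = m≤n+m (suc b) 1
  K-incr (suc (suc i)) = n<1+n _
  ch : ∀ i → Subset (suc (K i))
  ch 0 = s₀
  ch 1 = s₁
  ch (suc (suc i)) = filled (suc (suc (suc i))) b
  ch-size : ∀ i → ∣ ch i ∣ ≡ suc i
  ch-size 0 = ∣s₀∣≡1
  ch-size 1 = ∣s₁∣≡2
  ch-size (suc (suc i)) = ∣filled∣ (suc (suc (suc i))) b

⊆AR[2]-intro : ∀ {S′ S} → levelOf S′ 0 ⊑ S → levelOf S′ 1 ⊑ S → S′ ⊆AR[ 2 ] S
⊆AR[2]-intro L₀⊑S L₁⊑S 0 _ = L₀⊑S
⊆AR[2]-intro L₀⊑S L₁⊑S 1 _ = L₁⊑S
⊆AR[2]-intro L₀⊑S L₁⊑S (suc (suc _)) (s≤s (s≤s ()))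

OnAR₂ : R1 → (Level → Level → Set) → Set
OnAR₂ S Q = ∀ S′ → levelOf S′ 0 ⊑ S → levelOf S′ 1 ⊑ S → Q (levelOf S′ 0) (levelOf S′ 1)

module _ {U : Pred Node 0ℓ → Set} (U-ultra : IsUltrafilter U) where
  open IsUltrafilter U-ultra

  module _ (p : Node → ℕ) where
    open Cut U p

    bounded⇒constant : ∀ f M → pU (λ n → f n ≤ M) → IsConstantClass f
    bounded⇒constant f zero (Z , Z∈U , f≤0) = 0 , Z , Z∈U , λ x z → n≤0⇒n≡0 (f≤0 x z)
    bounded⇒constant f (suc M) (Z , Z∈U , f≤1+M) with ultra (λ x → f (p x) ≡ suc M)
    ... | inj₁ f≡1+M∈U = suc M , _ , f≡1+M∈U , λ _ → id
    ... | inj₂ f≢1+M∈U = bounded⇒constant f M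
      (_ , meet Z∈U f≢1+M∈U , λ x (z , f≢1+M) → ≤-pred (≤∧≢⇒< (f≤1+M x z) f≢1+M))

    InL-mono : ∀ {f h} → f ≤[ pU ] h → InL f → InL h
    InL-mono (Z , Z∈U , f≤h) (A , A∈U , g , count , Z′ , Z′∈U , g≤f) =
      A , A∈U , g , count , _ , meet Z′∈U Z∈U , λ x (z′ , z) → ≤-trans (g≤f x z′) (f≤h x z)

    constant⇒InS : (∀ m → InS (const m)) → ∀ {f} → IsConstantClass f → InS f
    constant⇒InS consts∈S {f} (m , Z , Z∈U , f≡m) =
      consts∈S m ∘ InL-mono {f} (Z , Z∈U , λ x z → ≤-reflexive (f≡m x z))

    CountIs-∩ : ∀ {A B g} → Decidable B → CountIs A g → Σ (ℕ → ℕ) (CountIs (A ∩ B))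
    CountIs-∩ {A} {B} B? count = (λ n → proj₁ (sized n)) , (λ n → proj₂ (sized n))
      where
      sized : ∀ n → ∃ (HasSize λ x → (A ∩ B) x × p x ≡ n)
      sized n = map₂ (HasSize-resp (λ _ ((a , pn) , b) → (a , b) , pn) (λ _ ((a , b) , pn) → (a , pn) , b))
                     (HasSize-∩ B? (count n))

  module _ {C : R1 → Set} (U-gen : GeneratedBy U C) where

    large⇒inhabited : ∀ {A} → U A → ∃ A
    large⇒inhabited A∈U with proj₂ U-gen _ A∈U
    ... | S , _ , S⊆A = node S 0 , S⊆A (node∈⟦⟧ S 0)

    -- An ultrafilter whose members are inhabited decides every proposition,
    -- through the constant predicates λ _ → P and λ _ → ¬ P.
    excluded-middle : (P : Set) → Dec P
    excluded-middle P with ultra (λ _ → P)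
    ... | inj₁ P∈U = yes (proj₂ (large⇒inhabited P∈U))
    ... | inj₂ ¬P∈U = no (proj₂ (large⇒inhabited ¬P∈U))

    large-avoids-height : ∀ n → U (λ x → proj₁ x ≢ n)
    large-avoids-height n with ultra (λ x → proj₁ x ≡ n)
    ... | inj₂ avoids = avoids
    ... | inj₁ at-n with proj₂ U-gen _ at-n
    ...   | T , _ , T⊆ =
      contradiction (trans (T⊆ (node∈⟦⟧ T 0)) (sym (T⊆ (node∈⟦⟧ T 1)))) (<⇒≢ (k-incr T 0))

    module _ (p : Node → ℕ) (f : ℕ → ℕ) where
      open Cut U p

      Apart : Level → Level → Set
      Apart L₀ L₁ = ∀ x → x ∈Level L₀ → ∀ y → y ∈Level L₁ → p x ≢ p y × 3 + proj₁ L₀ ≤ f (p y)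

      apart? : Vec Level 2 → Bool
      apart? (L₀ ∷ L₁ ∷ []) = does (excluded-middle (Apart L₀ L₁))

      homogeneous-for-Apart : RamseyR1 C →
        Σ R1 λ S → C S × Σ Bool λ b → OnAR₂ S λ L₀ L₁ → if b then Apart L₀ L₁ else ¬ Apart L₀ L₁
      homogeneous-for-Apart ramsey with ramsey 2 apart?
      ... | S , S∈C , b , hom = S , S∈C , b , λ S′ L₀⊑S L₁⊑S →
        invert (subst (Reflects _) (hom S′ (⊆AR[2]-intro {S′} {S} L₀⊑S L₁⊑S)) (proof (excluded-middle _)))

      module _ (S : R1) (hom : OnAR₂ S Apart) where

        apart-levels : ∀ {i j x y} → i < j → x ∈Level levelOf S i → y ∈Level levelOf S j →
                       p x ≢ p y × 3 + k S i ≤ f (p y)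
        apart-levels {i} {j} {_ , t} {_ , u} i<j (refl , t∈) (refl , u∈) with
          pair-containing u∈ (subst (2 ≤_) (sym (chosen-size S j)) (s≤s (≤-trans (s≤s z≤n) i<j)))
        ... | s₁ , ∣s₁∣≡2 , u∈s₁ , s₁⊆ =
          hom (twoLevels ⁅ t ⁆ s₁ (∣⁅x⁆∣≡1 t) ∣s₁∣≡2 (k-strictMono S i<j))
              (sublevel⊑ S i (x∈p⇒⁅x⁆⊆p t∈)) (sublevel⊑ S j s₁⊆)
              _ (refl , x∈⁅x⁆ t) _ (refl , u∈s₁)

        apart-same-level : ∀ {i j x y} → x ∈Level levelOf S i → y ∈Level levelOf S j → p x ≡ p y → i ≡ j
        apart-same-level {i} {j} x∈ y∈ px≡py with <-cmp i j
        ... | tri< i<j _ _ = contradiction px≡py (proj₁ (apart-levels i<j x∈ y∈))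
        ... | tri≈ _ i≡j _ = i≡j
        ... | tri> _ _ j<i = contradiction (sym px≡py) (proj₁ (apart-levels j<i y∈ x∈))

        Upper : Pred Node 0ℓ
        Upper x = ∃ λ m → x ∈Level levelOf S (suc m)

        apart⇒InL : C S → Σ (ℕ → ℕ) InL → InL f
        apart⇒InL S∈C (_ , A₀ , A₀∈U , _ , count₀ , _) =
          A₀ ∩ Upper , A∈U , g , count , A₀ ∩ Upper , A∈U , g≤f
          where
          A∈U : U (A₀ ∩ Upper)
          A∈U = upward (λ { (a , (zero , at-k₀ , _) , not-at-k₀) → contradiction at-k₀ not-at-k₀
                          ; (a , (suc m , x∈) , _) → a , m , x∈ })
                       (meet A₀∈U (meet (proj₁ U-gen S S∈C) (large-avoids-height (k S 0))))
          g : ℕ → ℕ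
          g = proj₁ (CountIs-∩ p (excluded-middle ∘ Upper) count₀)
          count : CountIs (A₀ ∩ Upper) g
          count = proj₂ (CountIs-∩ p (excluded-middle ∘ Upper) count₀)
          g≤f : ∀ y → (A₀ ∩ Upper) y → g (p y) ≤ f (p y)
          g≤f y (_ , m , y∈) = begin
            g (p y)              ≤⟨ HasSize-level≤ (count (p y)) fibre⊆level ⟩
            ∣ chosen S (suc m) ∣ ≡⟨ chosen-size S (suc m) ⟩
            2 + m                ≤⟨ s≤s (s≤s (i≤k S m)) ⟩
            2 + k S m            <⟨ n<1+n _ ⟩
            3 + k S m            ≤⟨ proj₂ (apart-levels (n<1+n m) (node∈level S m) y∈) ⟩
            f (p y)              ∎
            where
            open ≤-Reasoning
            fibre⊆level : ∀ x → (A₀ ∩ Upper) x × p x ≡ p y → x ∈Level levelOf S (suc m)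
            fibre⊆level x ((_ , _ , x∈) , px≡py) =
              subst (λ i → x ∈Level levelOf S i) (apart-same-level x∈ y∈ px≡py) x∈

      module _ (S : R1) (hom : OnAR₂ S λ L₀ L₁ → ¬ Apart L₀ L₁) where

        bound : ℕ
        bound = f (p (node S 0)) + (2 + k S 0)

        no-generator-above-bound : ∀ T → ⟦ T ⟧ ⊆ ⟦ S ⟧ ∩ (λ y → ¬ f (p y) ≤ bound) → ⊥
        no-generator-above-bound T T⊆ = hom
          (twoLevels ⁅ pick S 0 ⁆ (chosen T 1) (∣⁅x⁆∣≡1 (pick S 0)) (chosen-size T 1) k₀<)
          (sublevel⊑ S 0 (x∈p⇒⁅x⁆⊆p (pick∈ S 0))) (level⊑ {S} {T} (proj₁ ∘ T⊆) 1)
          apart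
          where
          k₀< : k S 0 < k T 1
          k₀< with height-in S (proj₁ (T⊆ (node∈⟦⟧ T 0)))
          ... | j , k₀T≡kⱼ = ≤-<-trans (≤-trans (k-mono S z≤n) (≤-reflexive (sym k₀T≡kⱼ))) (k-incr T 0)
          apart : Apart (k S 0 , ⁅ pick S 0 ⁆) (levelOf T 1)
          apart (_ , t) (refl , t∈) y y∈ with x∈⁅y⁆⇒x≡y (pick S 0) t∈
          ... | refl = (λ px≡py → above (subst (λ n → f n ≤ bound) px≡py (m≤m+n _ _)))
                     , ≤-trans (s≤s (m≤n+m _ _)) (≰⇒> above)
            where
            above : ¬ f (p y) ≤ bound
            above = proj₂ (T⊆ (1 , y∈))

        notApart⇒bounded : C S → pU (λ n → f n ≤ bound)
        notApart⇒bounded S∈C with ultra (λ y → f (p y) ≤ bound)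
        ... | inj₁ bounded∈U = _ , bounded∈U , λ _ → id
        ... | inj₂ above∈U with proj₂ U-gen _ (meet (proj₁ U-gen S S∈C) above∈U)
        ...   | T , _ , T⊆ = ⊥-elim (no-generator-above-bound T T⊆)

      InS⇒constant : RamseyR1 C → Σ (ℕ → ℕ) InL → InS f → IsConstantClass f
      InS⇒constant ramsey L≠∅ f∉L with homogeneous-for-Apart ramsey
      ... | S , S∈C , true , hom = contradiction (apart⇒InL S hom S∈C L≠∅) f∉L
      ... | S , S∈C , false , hom = bounded⇒constant p f _ (notApart⇒bounded S hom S∈C)

lemma4p1 : (U : Pred Node 0ℓ → Set) → IsUltrafilter U →
           (C : R1 → Set) → GeneratedBy U C → RamseyR1 C →
           (p : Node → ℕ) → Cut.Proper U p → Cut.Standard U p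
lemma4p1 U U-ultra C U-gen ramsey p (L≠∅ , consts∈S) f =
  InS⇒constant U-ultra U-gen p f ramsey L≠∅ , constant⇒InS U-ultra p consts∈S {f}
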